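{- Let $k$ be a commutative ring, $X,Y$ finite posets, $F:Y\to\mathcal{J}(X)$ an order-preserving map, $\Gamma$ the associated poset of generalized intervals, and $y\in Y$. Then the functor $i_y^{ -1}:\mathcal{F}_{\Gamma,k}\to\mathcal{F}_{F(y),k}$ is a left adjoint to the functor $(i_y)_\star:\mathcal{F}_{F(y),k}\to\mathcal{F}_{\Gamma,k}$.
   Context: For a poset $P$, $\mathcal{C}_P$ is the category with objects the elements of $P$ and exactly one morphism $p\to p'$ if $p\leqslant p'$, none otherwise, $k\mathcal{C}_P$ its $k$-linearization, and $\mathcal{F}_{P,k}$ the category of $k$-linear functors $k\mathcal{C}_P\to k\text{ -Mod}$. $\mathcal{J}(X)$ is the poset, under inclusion, of closed subsets $Z\subseteq X$ (i.e. $x\in Z$, $x'\leqslant x$ imply $x'\in Z$); $F$ order-preserving means $F(y)\subseteq F(y')$ for $y\leqslant y'$. $\Gamma=\{(x,y)\in X\times Y: x\in F(y)\}$ with the order induced from the product order on $X\times Y$. $F(y)$ is viewed as a subposet of $X$. The map $i_y:F(y)\to\Gamma$, $x\mapsto(x,y)$, is order preserving, and $i_y^{ -1}$ is precomposition with it: $(i_y^{ -1}\psi)(x)=\psi(x,y)$. For $\phi\in\mathcal{F}_{F(y),k}$, $(i_y)_\star\phi\in\mathcal{F}_{\Gamma,k}$ is defined by $(i_y)_\star\phi(a,b)=\mathrm{Hom}_k\big(\mathrm{Hom}_{k\mathcal{C}_\Gamma}((a,b),(a,y)),\phi(a)\big)$ if $b\leqslant y$ and $0$ otherwise; since $\mathrm{Hom}_{k\mathcal{C}_\Gamma}((a,b),(a,y))$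 is free of rank one on the unique morphism, this is canonically identified with $\phi(a)$ when $b\leqslant y$. Under this identification, $(i_y)_\star\phi$ sends the morphism $(a,b)\to(c,d)$ of $\Gamma$ to $\phi(a\to c)$ if $d\leqslant y$ and to $0$ otherwise; and for a natural transformation $\eta:\phi\Rightarrow\psi$, $(i_y)_\star\eta$ has component $\eta_a$ at $(a,b)$ when $b\leqslant y$ (and $0$ otherwise). -}

module Defs where

open import Level using (Level; _⊔_; suc)
open import Data.Bool using (Bool; true; false; T)
open import Data.Unit using (tt)
import Data.Unit.Polymorphic as P⊤
open import Data.Empty using (⊥-elim)
open import Data.Nat using (ℕ)
open import Data.Fin using (Fin)
open import Data.Product using (Σ; _×_; _,_; proj₁; proj₂)
open import Relation.Binary.PropositionalEquality using (_≡_)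
open import Algebra.Bundles using (CommutativeRing)
open import Algebra.Module.Bundles using (Module)
import Algebra.Module.Construct.Zero as Zero

-- Finite posets: carrier Fin n, order given by a Bool-valued relation
-- (so that x ≤ y := T (le x y) has at most one proof: C_P is thin).

record FinPoset (n : ℕ) : Set where
  field
    le      : Fin n → Fin n → Bool
    ≤-refl  : ∀ x → T (le x x)
    ≤-trans : ∀ {x y z} → T (le x y) → T (le y z) → T (le x z)
    ≤-anti  : ∀ {x y} → T (le x y) → T (le y x) → x ≡ y

  _≤_ : Fin n → Fin n → Set
  x ≤ y = T (le x y)

-- A subset Z of X (as a Bool-valued characteristic function) is closed
-- if x ∈ Z and x' ≤ x imply x' ∈ Z.  J(X) is the poset of these under ⊆.
IsClosed : ∀ {n} → FinPoset n → (Fin n → Bool) → Set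
IsClosed X Z = ∀ {x x'} → T (Z x) → FinPoset._≤_ X x' x → T (Z x')

record OrderPreservingToJ {nX nY : ℕ} (X : FinPoset nX) (Y : FinPoset nY) : Set where
  field
    F      : Fin nY → Fin nX → Bool
    closed : ∀ y → IsClosed X (F y)
    mono   : ∀ {y y'} → FinPoset._≤_ Y y y' → ∀ {x} → T (F y x) → T (F y' x)

-- k-modules, k-linear maps, and the category F_{P,k} of functors
-- C_P → k-Mod (= k-linear functors kC_P → k-Mod) for a poset given by
-- an order relation _≤_ on a carrier A (one morphism a → b iff a ≤ b).

module Lin {r ℓr : Level} (k : CommutativeRing r ℓr) {m ℓm : Level} where

  Mod : Set (r ⊔ ℓr ⊔ suc (m ⊔ ℓm))
  Mod = Module k m ℓm

  open Module using (Carrierᴹ; _≈ᴹ_; _+ᴹ_; _*ₗ_; 0ᴹ)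
  open CommutativeRing k using (Carrier)

  record LinMap (M N : Mod) : Set (r ⊔ m ⊔ ℓm) where
    field
      fun    : Carrierᴹ M → Carrierᴹ N
      cong   : ∀ {u v} → _≈ᴹ_ M u v → _≈ᴹ_ N (fun u) (fun v)
      +-homo : ∀ u v → _≈ᴹ_ N (fun (_+ᴹ_ M u v)) (_+ᴹ_ N (fun u) (fun v))
      *-homo : ∀ (s : Carrier) u → _≈ᴹ_ N (fun (_*ₗ_ M s u)) (_*ₗ_ N s (fun u))
  open LinMap public

  _≈L_ : ∀ {M N} → LinMap M N → LinMap M N → Set (m ⊔ ℓm)
  _≈L_ {M} {N} f g = ∀ u → _≈ᴹ_ N (fun f u) (fun g u)

  idL : ∀ {M} → LinMap M M
  idL {M} = record { fun = λ u → u ; cong = λ e → e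
                   ; +-homo = λ u v → Module.≈ᴹ-refl M
                   ; *-homo = λ s u → Module.≈ᴹ-refl M }

  _∘L_ : ∀ {M N P} → LinMap N P → LinMap M N → LinMap M P
  _∘L_ {M} {N} {P} g f = record
    { fun = λ u → fun g (fun f u)
    ; cong = λ e → cong g (cong f e)
    ; +-homo = λ u v → Module.≈ᴹ-trans P (cong g (+-homo f u v)) (+-homo g _ _)
    ; *-homo = λ s u → Module.≈ᴹ-trans P (cong g (*-homo f s u)) (*-homo g s _) }

  0M : Mod
  0M = Zero.⟨module⟩

  zeroFrom : ∀ {N} → LinMap 0M N
  zeroFrom {N} = record
    { fun = λ _ → 0ᴹ N
    ; cong = λ _ → Module.≈ᴹ-refl N
    ; +-homo = λ _ _ → Module.≈ᴹ-sym N (Module.+ᴹ-identityˡ N (0ᴹ N))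
    ; *-homo = λ s _ → Module.≈ᴹ-sym N (Module.*ₗ-zeroʳ N s) }

  zeroTo : ∀ {M} → LinMap M 0M
  zeroTo = record { fun = λ _ → P⊤.tt ; cong = λ _ → P⊤.tt
                  ; +-homo = λ _ _ → P⊤.tt ; *-homo = λ _ _ → P⊤.tt }

  record Rep {A : Set} (_≤_ : A → A → Set) : Set (r ⊔ ℓr ⊔ suc (m ⊔ ℓm)) where
    field
      obj   : A → Mod
      map   : ∀ {a b} → a ≤ b → LinMap (obj a) (obj b)
      map-id : ∀ {a} (p : a ≤ a) → map p ≈L idL
      map-∘  : ∀ {a b c} (p : a ≤ b) (q : b ≤ c) (pq : a ≤ c) →
               map pq ≈L (map q ∘L map p)
  open Rep public

  record NatT {A : Set} {_≤_ : A → A → Set} (φ ψ : Rep _≤_) : Set (r ⊔ m ⊔ ℓm) where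
    field
      comp    : ∀ a → LinMap (obj φ a) (obj ψ a)
      natural : ∀ {a b} (p : a ≤ b) (u : Carrierᴹ (obj φ a)) →
                _≈ᴹ_ (obj ψ b) (fun (map ψ p) (fun (comp a) u))
                                (fun (comp b) (fun (map φ p) u))
  open NatT public

  _≈N_ : ∀ {A} {_≤_ : A → A → Set} {φ ψ : Rep _≤_} → NatT φ ψ → NatT φ ψ → Set (m ⊔ ℓm)
  α ≈N β = ∀ a → comp α a ≈L comp β a

  _∘N_ : ∀ {A} {_≤_ : A → A → Set} {φ ψ χ : Rep _≤_} → NatT ψ χ → NatT φ ψ → NatT φ χ
  _∘N_ {χ = χ} β α = record
    { comp = λ a → comp β a ∘L comp α a
    ; natural = λ {a} {b} p u → Module.≈ᴹ-trans (obj χ b) (natural β p _)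
                                  (cong (comp β b) (natural α p u)) }

  record RepFunctor {A B : Set} (_≤₁_ : A → A → Set) (_≤₂_ : B → B → Set)
         : Set (r ⊔ ℓr ⊔ suc (m ⊔ ℓm)) where
    field
      F₀ : Rep _≤₁_ → Rep _≤₂_
      F₁ : ∀ {φ ψ} → NatT φ ψ → NatT (F₀ φ) (F₀ ψ)
  open RepFunctor public

  record Adjunction {A B : Set} {_≤₁_ : A → A → Set} {_≤₂_ : B → B → Set}
         (L : RepFunctor _≤₁_ _≤₂_) (R : RepFunctor _≤₂_ _≤₁_)
         : Set (r ⊔ ℓr ⊔ suc (m ⊔ ℓm)) where
    field
      to      : ∀ {ψ φ} → NatT (F₀ L ψ) φ → NatT ψ (F₀ R φ)
      from    : ∀ {ψ φ} → NatT ψ (F₀ R φ) → NatT (F₀ L ψ) φ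
      to-cong   : ∀ {ψ φ} {α β : NatT (F₀ L ψ) φ} → α ≈N β → to α ≈N to β
      from-cong : ∀ {ψ φ} {α β : NatT ψ (F₀ R φ)} → α ≈N β → from α ≈N from β
      from∘to : ∀ {ψ φ} (α : NatT (F₀ L ψ) φ) → from (to α) ≈N α
      to∘from : ∀ {ψ φ} (β : NatT ψ (F₀ R φ)) → to (from β) ≈N β
      to-natural : ∀ {ψ ψ' φ φ'} (f : NatT ψ' ψ) (g : NatT φ φ')
                   (α : NatT (F₀ L ψ) φ) →
                   to (g ∘N (α ∘N F₁ L f)) ≈N (F₁ R g ∘N (to α ∘N f))

module Intervals {nX nY : ℕ} (X : FinPoset nX) (Y : FinPoset nY)
                 (Fm : OrderPreservingToJ X Y) where
  open OrderPreservingToJ Fm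
  private
    module X = FinPoset X
    module Y = FinPoset Y

  Fy : Fin nY → Set
  Fy y = Σ (Fin nX) (λ x → T (F y x))

  _≤Fy_ : ∀ {y} → Fy y → Fy y → Set
  (x , _) ≤Fy (x' , _) = x X.≤ x'

  Γ : Set
  Γ = Σ (Fin nX × Fin nY) (λ xy → T (F (proj₂ xy) (proj₁ xy)))

  _≤Γ_ : Γ → Γ → Set
  ((x , y) , _) ≤Γ ((x' , y') , _) = (x X.≤ x') × (y Y.≤ y')

  i : (y : Fin nY) → Fy y → Γ
  i y (x , p) = ((x , y) , p)

  i-mono : ∀ y {a b : Fy y} → a ≤Fy b → i y a ≤Γ i y b
  i-mono y p = p , Y.≤-refl y

  module Functors {r ℓr : Level} (k : CommutativeRing r ℓr) {m ℓm : Level} where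
    open Lin k {m} {ℓm}

    restrict : (y : Fin nY) → RepFunctor _≤Γ_ (_≤Fy_ {y})
    restrict y = record
      { F₀ = λ ψ → record
          { obj = λ a → obj ψ (i y a)
          ; map = λ {a} {b} p → map ψ (i-mono y {a} {b} p)
          ; map-id = λ {a} p → map-id ψ (i-mono y {a} {a} p)
          ; map-∘ = λ {a} {b} {c} p q pq →
                      map-∘ ψ (i-mono y {a} {b} p) (i-mono y {b} {c} q) (i-mono y {a} {c} pq) }
      ; F₁ = λ α → record
          { comp = λ a → comp α (i y a)
          ; natural = λ {a} {b} p u → natural α (i-mono y {a} {b} p) u } }

    starObj : (β : Bool) → (T β → Mod) → Mod
    starObj true  M = M tt
    starObj false M = 0M

    starMap : (β δ : Bool) {M : T β → Mod} {N : T δ → Mod} →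
              ((q : T β) (q' : T δ) → LinMap (M q) (N q')) →
              LinMap (starObj β M) (starObj δ N)
    starMap true  true  f = f tt tt
    starMap false true  f = zeroFrom
    starMap true  false f = zeroTo
    starMap false false f = zeroTo

    starDiag : (β : Bool) {M N : T β → Mod} →
               ((q : T β) → LinMap (M q) (N q)) →
               LinMap (starObj β M) (starObj β N)
    starDiag true  f = f tt
    starDiag false f = zeroTo

    private
      linZero : ∀ {M N} (f : LinMap M N) →
                Module._≈ᴹ_ N (fun f (Module.0ᴹ M)) (Module.0ᴹ N)
      linZero {M} {N} f =
        Module.≈ᴹ-trans N (cong f (Module.≈ᴹ-sym M (Module.*ₗ-zeroˡ M (Module.0ᴹ M))))
          (Module.≈ᴹ-trans N (*-homo f _ _) (Module.*ₗ-zeroˡ N _))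

      starMap-id : (β : Bool) {M : T β → Mod}
                   (f : (q q' : T β) → LinMap (M q) (M q')) →
                   ((q : T β) → f q q ≈L idL) → starMap β β f ≈L idL
      starMap-id true  f h = h tt
      starMap-id false f h = λ _ → P⊤.tt

      starMap-∘ : (β δ ε : Bool) {M : T β → Mod} {N : T δ → Mod} {P : T ε → Mod}
                  (f : (q : T β) (q' : T ε) → LinMap (M q) (P q'))
                  (g : (q : T δ) (q' : T ε) → LinMap (N q) (P q'))
                  (h : (q : T β) (q' : T δ) → LinMap (M q) (N q')) →
                  (T ε → T δ) →
                  ((q : T β) (q' : T δ) (q'' : T ε) → f q q'' ≈L (g q' q'' ∘L h q q')) →
                  starMap β ε f ≈L (starMap δ ε g ∘L starMap β δ h)
      starMap-∘ β     δ     false f g h e H = λ _ → P⊤.tt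
      starMap-∘ β     false true  f g h e H = ⊥-elim (e tt)
      starMap-∘ true  true  true  f g h e H = H tt tt tt
      starMap-∘ false true  true {P = P} f g h e H =
        λ _ → Module.≈ᴹ-sym (P tt) (linZero (g tt tt))

      starNat : (β δ : Bool) {M M' : T β → Mod} {N N' : T δ → Mod}
                (f : (q : T β) (q' : T δ) → LinMap (M q) (N q'))
                (f' : (q : T β) (q' : T δ) → LinMap (M' q) (N' q'))
                (ηM : (q : T β) → LinMap (M q) (M' q))
                (ηN : (q : T δ) → LinMap (N q) (N' q)) →
                ((q : T β) (q' : T δ) → (f' q q' ∘L ηM q) ≈L (ηN q' ∘L f q q')) →
                (starMap β δ f' ∘L starDiag β ηM) ≈L (starDiag δ ηN ∘L starMap β δ f)
      starNat β     false f f' ηM ηN H = λ _ → P⊤.tt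
      starNat true  true  f f' ηM ηN H = H tt tt
      starNat false true {N' = N'} f f' ηM ηN H =
        λ _ → Module.≈ᴹ-sym (N' tt) (linZero (ηN tt))

    -- (i_y)_⋆ : under the canonical identification
    -- (i_y)_⋆ φ (a,b) = φ(a) if b ≤ y, and 0 otherwise.
    star : (y : Fin nY) → RepFunctor (_≤Fy_ {y}) _≤Γ_
    star y = record
      { F₀ = λ φ → record
          { obj = λ { ((a , b) , p) →
                      starObj (Y.le b y) (λ q → obj φ (a , mono q p)) }
          ; map = λ { {(a , b) , p} {(c , d) , p'} (ac , bd) →
                      starMap (Y.le b y) (Y.le d y) (λ q q' → map φ ac) }
          ; map-id = λ { {(a , b) , p} (aa , bb) →
                      starMap-id (Y.le b y) {λ q → obj φ (a , mono q p)}
                                 (λ q q' → map φ aa)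
                                 (λ q → map-id φ aa) }
          ; map-∘ = λ { {(a , b) , p} {(c , d) , p'} {(e , f) , p''}
                        (ac , bd) (ce , df) (ae , bf) →
                      starMap-∘ (Y.le b y) (Y.le d y) (Y.le f y)
                        {λ q → obj φ (a , mono q p)} {λ q → obj φ (c , mono q p')}
                        {λ q → obj φ (e , mono q p'')}
                        (λ q q' → map φ ae) (λ q q' → map φ ce)
                        (λ q q' → map φ ac) (λ fy → Y.≤-trans df fy)
                        (λ q q' q'' → map-∘ φ ac ce ae) } }
      ; F₁ = λ {φ} {φ'} α → record
          { comp = λ { ((a , b) , p) →
                       starDiag (Y.le b y) (λ q → comp α (a , mono q p)) }
          ; natural = λ { {(a , b) , p} {(c , d) , p'} (ac , bd) →
                       starNat (Y.le b y) (Y.le d y)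
                         {λ q → obj φ (a , mono q p)} {λ q → obj φ' (a , mono q p)}
                         {λ q → obj φ (c , mono q p')} {λ q → obj φ' (c , mono q p')}
                         (λ q q' → map φ ac) (λ q q' → map φ' ac)
                         (λ q → comp α (a , mono q p))
                         (λ q → comp α (c , mono q p'))
                         (λ q q' → natural α ac) } } }

-- For (a, b) ∈ Γ with b ≤ y there is an arrow (a, b) → (a, y) = i_y(a), and (i_y)_⋆φ is
-- φ(a) at such points and 0 elsewhere. So a transformation i_y^{-1}ψ ⇒ φ extends to
-- ψ ⇒ (i_y)_⋆φ by precomposing its component at a with ψ((a, b) → (a, y)); conversely a
-- transformation ψ ⇒ (i_y)_⋆φ restricts along i_y and is followed by the counit
-- (i_y)_⋆φ(a, y) = φ(a). Both round trips are identities, and the bijection is natural,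
-- because in a functor on a thin category any two composites with the same ends agree.

module Submission where

open import Level using (Level)
open import Data.Nat using (ℕ)
open import Data.Fin using (Fin)
open import Data.Bool using (Bool; true; false; T)
open import Data.Unit using (tt)
import Data.Unit.Polymorphic as P⊤
open import Data.Product using (_,_; proj₁)
open import Algebra.Bundles using (CommutativeRing)
open import Algebra.Module.Bundles using (Module)
import Relation.Binary.Reasoning.Setoid as SetoidReasoning
open import Defs

module RepProperties {r ℓr : Level} (k : CommutativeRing r ℓr) {m ℓm : Level}
    {A : Set} {_≤_ : A → A → Set} (φ : Lin.Rep k {m} {ℓm} _≤_) where
  open Lin k {m} {ℓm} renaming (_∘L_ to infixr 9 _∘L_)
  open Module using (≈ᴹ-trans; ≈ᴹ-sym)

  map-square : ∀ {a b c d} (p : a ≤ b) (q : b ≤ d) (s : a ≤ c) (t : c ≤ d) → a ≤ d →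
               (map φ q ∘L map φ p) ≈L (map φ t ∘L map φ s)
  map-square p q s t pt u =
    ≈ᴹ-trans (obj φ _) (≈ᴹ-sym (obj φ _) (map-∘ φ p q pt u)) (map-∘ φ s t pt u)

  map-cycle : ∀ {a b} (p : a ≤ b) (q : b ≤ a) → a ≤ a → (map φ q ∘L map φ p) ≈L idL
  map-cycle p q pp u =
    ≈ᴹ-trans (obj φ _) (≈ᴹ-sym (obj φ _) (map-∘ φ p q pp u)) (map-id φ pp u)

module StarObjProperties {r ℓr m ℓm : Level} (k : CommutativeRing r ℓr)
    {nX nY : ℕ} (X : FinPoset nX) (Y : FinPoset nY) (Fm : OrderPreservingToJ X Y) where
  open Lin k {m} {ℓm} renaming (_∘L_ to infixr 9 _∘L_; fun to infixr 9 _⟨$⟩_)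
  open Intervals.Functors X Y Fm k {m} {ℓm}
  open Module using (Carrierᴹ; _≈ᴹ_)

  starIntro : (β : Bool) {M : T β → Mod} {N : Mod} →
              ((q : T β) → LinMap N (M q)) → LinMap N (starObj β M)
  starIntro true  h = h tt
  starIntro false h = zeroTo

  starProj : (β : Bool) {M : T β → Mod} (q : T β) → LinMap (starObj β M) (M q)
  starProj true tt = idL

  starProj-starIntro : (β : Bool) {M : T β → Mod} {N : Mod}
                       (h : (q : T β) → LinMap N (M q)) (q : T β) →
                       (starProj β q ∘L starIntro β h) ≈L h q
  starProj-starIntro true {M} h tt _ = Module.≈ᴹ-refl (M tt)

  starObj-ext : (β : Bool) {M : T β → Mod} {v v′ : Carrierᴹ (starObj β M)} →
                ((q : T β) → _≈ᴹ_ (M q) (starProj β q ⟨$⟩ v) (starProj β q ⟨$⟩ v′)) →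
                _≈ᴹ_ (starObj β M) v v′
  starObj-ext true  e = e tt
  starObj-ext false e = P⊤.tt

  starIntro-cong : (β : Bool) {M : T β → Mod} {N : Mod} {h h′ : (q : T β) → LinMap N (M q)} →
                   ((q : T β) → h q ≈L h′ q) → starIntro β h ≈L starIntro β h′
  starIntro-cong true  e = e tt
  starIntro-cong false e = λ _ → P⊤.tt

  starProj-starMap : (β δ : Bool) {M : T β → Mod} {N : T δ → Mod}
                     (f : (q : T β) (q′ : T δ) → LinMap (M q) (N q′)) (q : T β) (q′ : T δ) →
                     (starProj δ q′ ∘L starMap β δ f) ≈L (f q q′ ∘L starProj β q)
  starProj-starMap true true {N = N} f tt tt _ = Module.≈ᴹ-refl (N tt)

  starProj-starDiag : (β : Bool) {M N : T β → Mod}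
                      (d : (q : T β) → LinMap (M q) (N q)) (q : T β) →
                      (starProj β q ∘L starDiag β d) ≈L (d q ∘L starProj β q)
  starProj-starDiag true {N = N} d tt _ = Module.≈ᴹ-refl (N tt)

module RestrictStarAdjunction {r ℓr m ℓm : Level} (k : CommutativeRing r ℓr)
    {nX nY : ℕ} (X : FinPoset nX) (Y : FinPoset nY) (Fm : OrderPreservingToJ X Y)
    (y : Fin nY) where
  open OrderPreservingToJ Fm
  private
    module X = FinPoset X
    module Y = FinPoset Y
  open Intervals X Y Fm
  open Functors k {m} {ℓm}
  open Lin k {m} {ℓm} renaming (_∘L_ to infixr 9 _∘L_; fun to infixr 9 _⟨$⟩_)
  open RepProperties k {m} {ℓm}
  open StarObjProperties {m = m} {ℓm} k X Y Fm
  open Module using (Carrierᴹ; _≈ᴹ_)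

  y≤y : y Y.≤ y
  y≤y = Y.≤-refl y

  below : Γ → Bool
  below ((_ , b) , _) = Y.le b y

  atY : (γ : Γ) → T (below γ) → Fy y
  atY ((a , _) , p) q = a , mono q p

  raise : (ψ : Rep _≤Γ_) (γ : Γ) (q : T (below γ)) → LinMap (obj ψ γ) (obj ψ (i y (atY γ q)))
  raise ψ γ@((a , _) , p) q = map ψ {γ} {i y (atY γ q)} (X.≤-refl a , q)

  module _ (φ : Rep (_≤Fy_ {y})) where
    private
      R = F₀ (star y) φ

    -- Proofs of a ∈ F(y) are not definitionally unique, so φ has one copy of φ(a) per
    -- proof; relabel is the identity arrow of a between two of them.
    relabel : ∀ {a} (p p′ : T (F y a)) → LinMap (obj φ (a , p)) (obj φ (a , p′))
    relabel {a} p p′ = map φ {a , p} {a , p′} (X.≤-refl a)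

    starProj-map : (γ δ : Γ) (pp : γ ≤Γ δ) (q : T (below γ)) (q′ : T (below δ)) →
                   (starProj (below δ) q′ ∘L map R pp)
                     ≈L (map φ {atY γ q} {atY δ q′} (proj₁ pp) ∘L starProj (below γ) q)
    starProj-map ((a , b) , p) ((c , d) , p′) (ac , _) =
      starProj-starMap (Y.le b y) (Y.le d y)
        {λ q → obj φ (a , mono q p)} {λ q′ → obj φ (c , mono q′ p′)} (λ _ _ → map φ ac)

    star-ext : (γ : Γ) {v v′ : Carrierᴹ (obj R γ)} →
               ((q : T (below γ)) →
                  _≈ᴹ_ (obj φ (atY γ q)) (starProj (below γ) q ⟨$⟩ v) (starProj (below γ) q ⟨$⟩ v′)) →
               _≈ᴹ_ (obj R γ) v v′
    star-ext ((a , b) , p) = starObj-ext (Y.le b y) {λ q → obj φ (a , mono q p)}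

    counit : (x : Fy y) → LinMap (obj R (i y x)) (obj φ x)
    counit (a , pa) = relabel (mono y≤y pa) pa ∘L starProj (Y.le y y) y≤y

    counit-natural : ∀ {x x′} (ac : x ≤Fy x′) →
                     (map φ ac ∘L counit x) ≈L (counit x′ ∘L map R (i-mono y {x} {x′} ac))
    counit-natural {a , pa} {c , pc} ac u = begin
      map φ ac ⟨$⟩ relabel (mono y≤y pa) pa ⟨$⟩ starProj (Y.le y y) y≤y ⟨$⟩ u
        ≈⟨ map-square φ (X.≤-refl a) ac ac (X.≤-refl c) ac (starProj (Y.le y y) y≤y ⟨$⟩ u) ⟩
      relabel (mono y≤y pc) pc ⟨$⟩ map φ ac ⟨$⟩ starProj (Y.le y y) y≤y ⟨$⟩ u
        ≈˘⟨ cong (relabel (mono y≤y pc) pc)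
                 (starProj-map (i y (a , pa)) (i y (c , pc)) (ac , y≤y) y≤y y≤y u) ⟩
      relabel (mono y≤y pc) pc ⟨$⟩ starProj (Y.le y y) y≤y ⟨$⟩ map R (ac , y≤y) ⟨$⟩ u ∎
      where open SetoidReasoning (Module.≈ᴹ-setoid (obj φ (c , pc)))

    counit-raise : (γ : Γ) (q : T (below γ)) →
                   (counit (atY γ q) ∘L raise R γ q) ≈L starProj (below γ) q
    counit-raise ((a , b) , p) q u = begin
      relabel (mono y≤y p′) p′ ⟨$⟩ starProj (Y.le y y) y≤y ⟨$⟩ map R (X.≤-refl a , q) ⟨$⟩ u
        ≈⟨ cong (relabel (mono y≤y p′) p′)
                (starProj-map ((a , b) , p) ((a , y) , p′) (X.≤-refl a , q) q y≤y u) ⟩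
      relabel (mono y≤y p′) p′ ⟨$⟩ relabel (mono q p) (mono y≤y p′) ⟨$⟩ starProj (Y.le b y) q ⟨$⟩ u
        ≈⟨ map-cycle φ (X.≤-refl a) (X.≤-refl a) (X.≤-refl a) (starProj (Y.le b y) q ⟨$⟩ u) ⟩
      starProj (Y.le b y) q ⟨$⟩ u ∎
      where
      p′ = mono q p
      open SetoidReasoning (Module.≈ᴹ-setoid (obj φ (a , p′)))

  module _ {ψ : Rep _≤Γ_} {φ : Rep (_≤Fy_ {y})} where
    private
      L = F₀ (restrict y) ψ
      R = F₀ (star y) φ

    Ladjunct-comp : NatT L φ → (γ : Γ) → LinMap (obj ψ γ) (obj R γ)
    Ladjunct-comp α γ@((_ , b) , _) = starIntro (Y.le b y) (λ q → comp α (atY γ q) ∘L raise ψ γ q)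

    starProj-Ladjunct : (α : NatT L φ) (γ : Γ) (q : T (below γ)) →
                        (starProj (below γ) q ∘L Ladjunct-comp α γ) ≈L (comp α (atY γ q) ∘L raise ψ γ q)
    starProj-Ladjunct α γ@((a , b) , p) =
      starProj-starIntro (Y.le b y) {λ q → obj φ (a , mono q p)}
        (λ q → comp α (atY γ q) ∘L raise ψ γ q)

    Ladjunct-comp-natural : (α : NatT L φ) {γ δ : Γ} (pp : γ ≤Γ δ) →
                            (map R pp ∘L Ladjunct-comp α γ) ≈L (Ladjunct-comp α δ ∘L map ψ pp)
    Ladjunct-comp-natural α {γ@((a , b) , p)} {δ@((c , d) , p′)} pp@(ac , bd) =
      λ u → star-ext φ δ λ q′ →
        let q = Y.≤-trans bd q′
            open SetoidReasoning (Module.≈ᴹ-setoid (obj φ (atY δ q′)))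
        in begin
        starProj (below δ) q′ ⟨$⟩ map R pp ⟨$⟩ Ladjunct-comp α γ ⟨$⟩ u
          ≈⟨ starProj-map φ γ δ pp q q′ (Ladjunct-comp α γ ⟨$⟩ u) ⟩
        map φ ac ⟨$⟩ starProj (below γ) q ⟨$⟩ Ladjunct-comp α γ ⟨$⟩ u
          ≈⟨ cong (map φ ac) (starProj-Ladjunct α γ q u) ⟩
        map φ ac ⟨$⟩ comp α (atY γ q) ⟨$⟩ raise ψ γ q ⟨$⟩ u
          ≈⟨ natural α ac (raise ψ γ q ⟨$⟩ u) ⟩
        comp α (atY δ q′) ⟨$⟩ map ψ (ac , y≤y) ⟨$⟩ raise ψ γ q ⟨$⟩ u
          ≈⟨ cong (comp α (atY δ q′))
                  (map-square ψ (X.≤-refl a , q) (ac , y≤y) pp (X.≤-refl c , q′) (ac , q) u) ⟩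
        comp α (atY δ q′) ⟨$⟩ raise ψ δ q′ ⟨$⟩ map ψ pp ⟨$⟩ u
          ≈˘⟨ starProj-Ladjunct α δ q′ (map ψ pp ⟨$⟩ u) ⟩
        starProj (below δ) q′ ⟨$⟩ Ladjunct-comp α δ ⟨$⟩ map ψ pp ⟨$⟩ u ∎

    Ladjunct : NatT L φ → NatT ψ R
    Ladjunct α = record { comp = Ladjunct-comp α ; natural = Ladjunct-comp-natural α }

    Radjunct-comp : NatT ψ R → (x : Fy y) → LinMap (obj L x) (obj φ x)
    Radjunct-comp β x = counit φ x ∘L comp β (i y x)

    Radjunct-comp-natural : (β : NatT ψ R) {x x′ : Fy y} (ac : x ≤Fy x′) →
                            (map φ ac ∘L Radjunct-comp β x) ≈L (Radjunct-comp β x′ ∘L map L ac)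
    Radjunct-comp-natural β {x} {x′} ac u = begin
      map φ ac ⟨$⟩ counit φ x ⟨$⟩ comp β (i y x) ⟨$⟩ u
        ≈⟨ counit-natural φ ac (comp β (i y x) ⟨$⟩ u) ⟩
      counit φ x′ ⟨$⟩ map R ac↑ ⟨$⟩ comp β (i y x) ⟨$⟩ u
        ≈⟨ cong (counit φ x′) (natural β ac↑ u) ⟩
      counit φ x′ ⟨$⟩ comp β (i y x′) ⟨$⟩ map ψ ac↑ ⟨$⟩ u ∎
      where
      ac↑ = i-mono y {x} {x′} ac
      open SetoidReasoning (Module.≈ᴹ-setoid (obj φ x′))

    Radjunct : NatT ψ R → NatT L φ
    Radjunct β = record { comp = Radjunct-comp β ; natural = Radjunct-comp-natural β }

    Radjunct-Ladjunct : (α : NatT L φ) → Radjunct (Ladjunct α) ≈N α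
    Radjunct-Ladjunct α x@(a , pa) u = begin
      relabel φ (mono y≤y pa) pa ⟨$⟩ starProj (Y.le y y) y≤y ⟨$⟩ Ladjunct-comp α (i y x) ⟨$⟩ u
        ≈⟨ cong (relabel φ (mono y≤y pa) pa) (starProj-Ladjunct α (i y x) y≤y u) ⟩
      relabel φ (mono y≤y pa) pa ⟨$⟩ comp α (a , mono y≤y pa) ⟨$⟩ raise ψ (i y x) y≤y ⟨$⟩ u
        ≈⟨ natural α (X.≤-refl a) (raise ψ (i y x) y≤y ⟨$⟩ u) ⟩
      comp α x ⟨$⟩ map ψ ay≤ay ⟨$⟩ raise ψ (i y x) y≤y ⟨$⟩ u
        ≈⟨ cong (comp α x) (map-cycle ψ ay≤ay ay≤ay ay≤ay u) ⟩
      comp α x ⟨$⟩ u ∎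
      where
      ay≤ay = X.≤-refl a , y≤y
      open SetoidReasoning (Module.≈ᴹ-setoid (obj φ x))

    Ladjunct-Radjunct : (β : NatT ψ R) → Ladjunct (Radjunct β) ≈N β
    Ladjunct-Radjunct β γ@((a , _) , _) u = star-ext φ γ λ q →
      let open SetoidReasoning (Module.≈ᴹ-setoid (obj φ (atY γ q))) in begin
      starProj (below γ) q ⟨$⟩ Ladjunct-comp (Radjunct β) γ ⟨$⟩ u
        ≈⟨ starProj-Ladjunct (Radjunct β) γ q u ⟩
      counit φ (atY γ q) ⟨$⟩ comp β (i y (atY γ q)) ⟨$⟩ raise ψ γ q ⟨$⟩ u
        ≈˘⟨ cong (counit φ (atY γ q)) (natural β (X.≤-refl a , q) u) ⟩
      counit φ (atY γ q) ⟨$⟩ raise R γ q ⟨$⟩ comp β γ ⟨$⟩ u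
        ≈⟨ counit-raise φ γ q (comp β γ ⟨$⟩ u) ⟩
      starProj (below γ) q ⟨$⟩ comp β γ ⟨$⟩ u ∎

    Ladjunct-cong : {α α′ : NatT L φ} → α ≈N α′ → Ladjunct α ≈N Ladjunct α′
    Ladjunct-cong e γ@((_ , b) , _) =
      starIntro-cong (Y.le b y) λ q u → e (atY γ q) (raise ψ γ q ⟨$⟩ u)

    Radjunct-cong : {β β′ : NatT ψ R} → β ≈N β′ → Radjunct β ≈N Radjunct β′
    Radjunct-cong e x u = cong (counit φ x) (e (i y x) u)

  Ladjunct-natural : {ψ ψ′ : Rep _≤Γ_} {φ φ′ : Rep (_≤Fy_ {y})}
                     (f : NatT ψ′ ψ) (g : NatT φ φ′) (α : NatT (F₀ (restrict y) ψ) φ) →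
                     Ladjunct (g ∘N (α ∘N F₁ (restrict y) f)) ≈N (F₁ (star y) g ∘N (Ladjunct α ∘N f))
  Ladjunct-natural {ψ} {ψ′} {φ} {φ′} f g α γ@((a , _) , _) u = star-ext φ′ γ λ q →
    let t = atY γ q
        open SetoidReasoning (Module.≈ᴹ-setoid (obj φ′ t))
    in begin
    starProj (below γ) q ⟨$⟩ Ladjunct-comp {ψ′} {φ′} (g ∘N (α ∘N F₁ (restrict y) f)) γ ⟨$⟩ u
      ≈⟨ starProj-Ladjunct {ψ′} {φ′} (g ∘N (α ∘N F₁ (restrict y) f)) γ q u ⟩
    comp g t ⟨$⟩ comp α t ⟨$⟩ comp f (i y t) ⟨$⟩ raise ψ′ γ q ⟨$⟩ u
      ≈˘⟨ cong (comp g t) (cong (comp α t) (natural f (X.≤-refl a , q) u)) ⟩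
    comp g t ⟨$⟩ comp α t ⟨$⟩ raise ψ γ q ⟨$⟩ comp f γ ⟨$⟩ u
      ≈˘⟨ cong (comp g t) (starProj-Ladjunct {ψ} {φ} α γ q (comp f γ ⟨$⟩ u)) ⟩
    comp g t ⟨$⟩ starProj (below γ) q ⟨$⟩ Ladjunct-comp {ψ} {φ} α γ ⟨$⟩ comp f γ ⟨$⟩ u
      ≈˘⟨ starProj-starDiag (below γ) (λ q → comp g (atY γ q)) q
            (Ladjunct-comp {ψ} {φ} α γ ⟨$⟩ comp f γ ⟨$⟩ u) ⟩
    starProj (below γ) q ⟨$⟩ comp (F₁ (star y) g) γ ⟨$⟩ Ladjunct-comp {ψ} {φ} α γ ⟨$⟩ comp f γ ⟨$⟩ u ∎

  adjunction : Adjunction (restrict y) (star y)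
  adjunction = record
    { to         = λ {ψ} {φ} → Ladjunct {ψ} {φ}
    ; from       = λ {ψ} {φ} → Radjunct {ψ} {φ}
    ; to-cong    = λ {ψ} {φ} {α} {α′} → Ladjunct-cong {ψ} {φ} {α} {α′}
    ; from-cong  = λ {ψ} {φ} {β} {β′} → Radjunct-cong {ψ} {φ} {β} {β′}
    ; from∘to    = λ {ψ} {φ} → Radjunct-Ladjunct {ψ} {φ}
    ; to∘from    = λ {ψ} {φ} → Ladjunct-Radjunct {ψ} {φ}
    ; to-natural = Ladjunct-natural
    }

lemma4p2 : ∀ {r ℓr m ℓm : Level} (k : CommutativeRing r ℓr)
    {nX nY : ℕ} (X : FinPoset nX) (Y : FinPoset nY)
    (F : OrderPreservingToJ X Y) (y : Fin nY) →
    Lin.Adjunction k {m} {ℓm}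
      (Intervals.Functors.restrict X Y F k {m} {ℓm} y)
      (Intervals.Functors.star X Y F k {m} {ℓm} y)
lemma4p2 {m = m} {ℓm} k X Y F y = RestrictStarAdjunction.adjunction {m = m} {ℓm} k X Y F y
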